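{- Let $d\ge2$ and $q\ge3$ be integers, let $G$ be a connected $K_{1,d}$-free graph without induced cycles of length at least $q$, let $h\ge q-1$ be an integer, let $P$ be an induced path on at least $h$ vertices in $G$, and let $(B,\beta)$ be the $h$-backbone structure of $P$ in $G$. Then $(B,\beta)$ is a path decomposition of $G[N[V(P)]]$ with independence number at most $(d-1)h$.
   Context: Graphs are finite and simple; $K_{1,d}$-free means no induced star with $d$ leaves; $N[X]$ is the closed neighborhood of a vertex set $X$ in $G$. For an induced path $P=v_1\dots v_\ell$ in $G$ with $\ell\ge h\ge1$, let $n=\ell-h+1$, let $B=b_1\dots b_n$ be a path, and for $i\in[n]$ let $P^i=v_iv_{i+1}\dots v_{i+h-1}$ and $\beta(b_i)=N_G[V(P^i)]$; the pair $(B,\beta)$ is the $h$-backbone structure of $P$ in $G$. A path decomposition of a graph $G'$ is a pair $(B,\beta)$ with $B$ a path and $\beta:V(B)\to 2^{V(G')}$ such that every vertex lies in some bag, every edge has both endpoints in some bag, and for each vertex the nodes whose bags contain it induce a subpath; its independence number is $\max_b\alpha(G'[\beta(b)])$. -}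

module Defs where

open import Level using (0ℓ)
open import Data.Nat using (ℕ; zero; suc; _+_; _*_; _∸_; _≤_; _<_)
open import Data.Fin using (Fin; toℕ)
open import Data.Product using (Σ; ∃; _×_; _,_)
open import Data.Sum using (_⊎_)
open import Data.List using (List; length)
open import Data.List.Membership.Propositional using (_∈_)
open import Data.List.Relation.Unary.All using (All)
open import Data.List.Relation.Unary.Unique.Propositional using (Unique)
open import Relation.Nullary using (¬_)
open import Relation.Binary.PropositionalEquality using (_≡_)
open import Relation.Binary using (Decidable)
open import Function.Definitions using (Injective)

record Graph : Set₁ where
  field
    n     : ℕ
    Adj   : Fin n → Fin n → Set
    adj?  : Decidable Adj
    sym   : ∀ {u v} → Adj u v → Adj v u
    irr   : ∀ {u} → ¬ Adj u u

module _ (G : Graph) where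
  open Graph G

  V : Set
  V = Fin n

  VSet : Set₁
  VSet = V → Set

  data Walk : V → V → Set where
    here : ∀ {u} → Walk u u
    step : ∀ {u v w} → Adj u v → Walk v w → Walk u w

  Connected : Set
  Connected = ∀ u v → Walk u v

  InducedStar : ℕ → Set
  InducedStar d = Σ V λ c → Σ (Fin d → V) λ f →
    Injective _≡_ _≡_ f × (∀ i → Adj c (f i)) × (∀ i j → ¬ Adj (f i) (f j))

  K1-Free : ℕ → Set
  K1-Free d = ¬ InducedStar d

  CycAdj : (k : ℕ) → Fin k → Fin k → Set
  CycAdj k i j = (suc (toℕ i) ≡ toℕ j) ⊎ (suc (toℕ j) ≡ toℕ i)
               ⊎ ((suc (toℕ i) ≡ k) × (toℕ j ≡ 0))
               ⊎ ((suc (toℕ j) ≡ k) × (toℕ i ≡ 0))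

  InducedCycle : ℕ → Set
  InducedCycle k = 3 ≤ k × Σ (Fin k → V) λ f →
    Injective _≡_ _≡_ f × (∀ i j → (Adj (f i) (f j) → CycAdj k i j) × (CycAdj k i j → Adj (f i) (f j)))

  NoLongHoles : ℕ → Set
  NoLongHoles q = ∀ k → q ≤ k → ¬ InducedCycle k

  PathAdj : (l : ℕ) → Fin l → Fin l → Set
  PathAdj l i j = (suc (toℕ i) ≡ toℕ j) ⊎ (suc (toℕ j) ≡ toℕ i)

  IsInducedPath : (l : ℕ) → (Fin l → V) → Set
  IsInducedPath l f = Injective _≡_ _≡_ f ×
    (∀ i j → (Adj (f i) (f j) → PathAdj l i j) × (PathAdj l i j → Adj (f i) (f j)))

  N[_] : VSet → VSet
  N[ X ] v = Σ V λ u → X u × (v ≡ u ⊎ Adj v u)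

  Img : ∀ {l} → (Fin l → V) → VSet
  Img f v = ∃ λ m → v ≡ f m

  -- vertex set of the subpath P^i = v_i … v_{i+h-1}  (0-indexed: positions i … i+h-1)
  SubImg : ∀ {l} → (Fin l → V) → (h i : ℕ) → VSet
  SubImg f h i v = ∃ λ m → (i ≤ toℕ m) × (toℕ m < i + h) × (v ≡ f m)

  -- h-backbone structure: bags indexed by Fin (l - h + 1), path B = b_0 … b_{l-h}
  backbone : ∀ {l} → (Fin l → V) → (h : ℕ) → Fin (l ∸ h + 1) → VSet
  backbone f h i = N[ SubImg f h (toℕ i) ]

  Independent : List V → Set
  Independent xs = Unique xs × (∀ {u v} → u ∈ xs → v ∈ xs → ¬ Adj u v)

  IndepNumberAtMost : VSet → ℕ → Set
  IndepNumberAtMost S k = ∀ xs → Independent xs → All S xs → length xs ≤ k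

  -- (B, β) with B the path on m nodes 0 … m-1 is a path decomposition of G[X]
  IsPathDecomposition : (X : VSet) → (m : ℕ) → (Fin m → VSet) → Set
  IsPathDecomposition X m β =
      (∀ b v → β b v → X v)
    × (∀ v → X v → ∃ λ b → β b v)
    × (∀ u v → X u → X v → Adj u v → ∃ λ b → β b u × β b v)
    × (∀ v (i j k : Fin m) → toℕ i ≤ toℕ j → toℕ j ≤ toℕ k → β i v → β k v → β j v)

  PathDecompIndepAtMost : (m : ℕ) → (Fin m → VSet) → ℕ → Set
  PathDecompIndepAtMost m β k = ∀ b → IndepNumberAtMost (β b) k

-- Independence: a bag is the union of the closed neighbourhoods of h path vertices, and in a
-- K_{1,d}-free graph an independent set meets each closed neighbourhood in at most d - 1 vertices.
--
-- Path decomposition: call position t of P an attachment of x if x ∈ N[v_t]. The bags containing x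
-- are the windows of h consecutive positions that contain an attachment of x. If two adjacent
-- vertices had all their attachments at distance ≥ h, or if the attachments of a single vertex
-- had a gap of h consecutive positions, then taking the last attachment before the gap and the
-- first one after it, the path segment between them together with the vertex (or the edge) would
-- be an induced cycle of length ≥ h + 3 > q. Hence every edge lies in a common bag and the bags
-- containing a vertex are consecutive.
module Submission where

open import Defs
open import Data.Nat using (ℕ; _≤_; _∸_; _+_; _*_)
open import Data.Fin using (Fin)
open import Data.Product using (_×_)

open import Data.Nat using (zero; suc; _<_; z≤n; s≤s; _≤?_; _<?_)
open import Data.Nat.Properties
open import Data.Fin using (toℕ; fromℕ<; inject≤)
import Data.Fin as Fin
open import Data.Fin.Properties using (toℕ<n; toℕ-fromℕ<; fromℕ<-toℕ; toℕ-injective; inject≤-injective)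
open import Data.Product using (∃; _,_; proj₁; proj₂)
open import Data.Sum using (_⊎_; inj₁; inj₂; [_,_])
import Data.Sum as Sum
open import Data.Empty using (⊥; ⊥-elim)
open import Data.List using (List; []; _∷_; length; filter; lookup)
open import Data.List.Membership.Propositional using (_∈_)
import Data.List.Membership.DecPropositional as DecMembership
open import Data.List.Membership.Propositional.Properties using (∈-lookup; ∈-filter⁻)
open import Data.List.Relation.Unary.All using (All; []; _∷_)
open import Data.List.Relation.Unary.AllPairs using ([]; _∷_)
import Data.List.Relation.Unary.All as All
open import Data.List.Relation.Unary.All.Properties using (all-filter; filter⁺)
open import Data.List.Relation.Unary.Unique.Propositional using (Unique)
import Data.List.Relation.Unary.Unique.Propositional.Properties as Unique
open import Function using (_∘_)
open import Relation.Nullary using (¬_; Dec; yes; no)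
open import Relation.Nullary.Decidable using (_×-dec_; _⊎-dec_)
open import Relation.Unary using (Decidable)
open import Relation.Unary.Properties using (∁?)
open import Relation.Binary.PropositionalEquality hiding ([_])

m<n⇒m≤n∸1 : ∀ {m n} → m < n → m ≤ n ∸ 1
m<n⇒m≤n∸1 (s≤s m≤n) = m≤n

length-filter+filter-∁ : ∀ {A : Set} {P : A → Set} (P? : Decidable P) xs →
  length (filter P? xs) + length (filter (∁? P?) xs) ≡ length xs
length-filter+filter-∁ P? [] = refl
length-filter+filter-∁ P? (x ∷ xs) with P? x
... | yes _ = cong suc (length-filter+filter-∁ P? xs)
... | no _ = trans (+-suc _ _) (cong suc (length-filter+filter-∁ P? xs))

Unique⇒lookup-injective : ∀ {A : Set} {xs : List A} → Unique xs → ∀ i j → lookup xs i ≡ lookup xs j → i ≡ j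
Unique⇒lookup-injective (_ ∷ _) Fin.zero Fin.zero _ = refl
Unique⇒lookup-injective (x∉ ∷ _) Fin.zero (Fin.suc j) e = ⊥-elim (All.lookup x∉ (∈-lookup j) e)
Unique⇒lookup-injective (x∉ ∷ _) (Fin.suc i) Fin.zero e = ⊥-elim (All.lookup x∉ (∈-lookup i) (sym e))
Unique⇒lookup-injective (_ ∷ u) (Fin.suc i) (Fin.suc j) e = cong Fin.suc (Unique⇒lookup-injective u i j e)

Unique-constant⇒length≤1 : ∀ {A : Set} {w : A} {xs} → Unique xs → All (_≡ w) xs → length xs ≤ 1
Unique-constant⇒length≤1 {xs = []} _ _ = z≤n
Unique-constant⇒length≤1 {xs = _ ∷ []} _ _ = s≤s z≤n
Unique-constant⇒length≤1 {xs = _ ∷ _ ∷ _} (x∉ ∷ _) (x≡w ∷ y≡w ∷ _) =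
  ⊥-elim (All.head x∉ (trans x≡w (sym y≡w)))

module _ {P : ℕ → Set} (P? : Decidable P) where

  last-below : ∀ b → (∃ λ t → t < b × P t) → ∃ λ A → A < b × P A × (∀ t → A < t → t < b → ¬ P t)
  last-below zero (_ , () , _)
  last-below (suc b) (t , t<1+b , pt) with P? b
  ... | yes pb = b , ≤-refl , pb , λ s b<s s<1+b _ → <⇒≱ b<s (m<1+n⇒m≤n s<1+b)
  ... | no ¬pb with m<1+n⇒m<n∨m≡n t<1+b
  ...   | inj₂ refl = ⊥-elim (¬pb pt)
  ...   | inj₁ t<b with last-below b (t , t<b , pt)
  ...     | A , A<b , pA , none = A , m<n⇒m<1+n A<b , pA , none′
    where
      none′ : ∀ s → A < s → s < suc b → ¬ P s
      none′ s A<s s<1+b with m<1+n⇒m<n∨m≡n s<1+b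
      ... | inj₁ s<b = none s A<s s<b
      ... | inj₂ refl = ¬pb

  first-from : ∀ {a} b → (∃ λ t → t < b × a ≤ t × P t) →
    ∃ λ B → B < b × a ≤ B × P B × (∀ t → a ≤ t → t < B → ¬ P t)
  first-from zero (_ , () , _)
  first-from {a} (suc b) (t , t<1+b , a≤t , pt) with anyUpTo? (λ s → (a ≤? s) ×-dec P? s) b
  ... | yes earlier with first-from b earlier
  ...   | B , B<b , a≤B , pB , none = B , m<n⇒m<1+n B<b , a≤B , pB , none
  first-from {a} (suc b) (t , t<1+b , a≤t , pt) | no ¬earlier with m<1+n⇒m<n∨m≡n t<1+b
  ... | inj₁ t<b = ⊥-elim (¬earlier (t , t<b , a≤t , pt))
  ... | inj₂ refl = t , ≤-refl , a≤t , pt , λ s a≤s s<t ps → ¬earlier (s , s<t , a≤s , ps)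

Consecutive : ℕ → ℕ → Set
Consecutive s t = suc s ≡ t ⊎ suc t ≡ s

Consecutive-+ : ∀ a {s t} → Consecutive s t → Consecutive (a + s) (a + t)
Consecutive-+ a {s} {t} = Sum.map (λ e → trans (sym (+-suc a s)) (cong (a +_) e))
                                  (λ e → trans (sym (+-suc a t)) (cong (a +_) e))

Consecutive-cancel : ∀ a {s t} → Consecutive (a + s) (a + t) → Consecutive s t
Consecutive-cancel a {s} {t} = Sum.map (λ e → +-cancelˡ-≡ a _ _ (trans (+-suc a s) e))
                                       (λ e → +-cancelˡ-≡ a _ _ (trans (+-suc a t) e))

-- Nested so that CycAdj G k i j unfolds to CyclicallyConsecutive k (toℕ i) (toℕ j).
CyclicallyConsecutive : ℕ → ℕ → ℕ → Set
CyclicallyConsecutive k s t =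
  (suc s ≡ t) ⊎ (suc t ≡ s) ⊎ ((suc s ≡ k) × (t ≡ 0)) ⊎ ((suc t ≡ k) × (s ≡ 0))

CyclicallyConsecutive-sym : ∀ {k s t} → CyclicallyConsecutive k s t → CyclicallyConsecutive k t s
CyclicallyConsecutive-sym (inj₁ e) = inj₂ (inj₁ e)
CyclicallyConsecutive-sym (inj₂ (inj₁ e)) = inj₁ e
CyclicallyConsecutive-sym (inj₂ (inj₂ (inj₁ e))) = inj₂ (inj₂ (inj₂ e))
CyclicallyConsecutive-sym (inj₂ (inj₂ (inj₂ e))) = inj₂ (inj₂ (inj₁ e))

Consecutive⇒CyclicallyConsecutive : ∀ {k s t} → Consecutive s t → CyclicallyConsecutive k s t
Consecutive⇒CyclicallyConsecutive = [ inj₁ , inj₂ ∘ inj₁ ]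

module _ (G : Graph) where
  open Graph G using (Adj; adj?; irr) renaming (sym to Adj-sym)
  open DecMembership (Fin._≟_ {Graph.n G}) using (_∈?_)

  infix 4 _∈N[_]
  _∈N[_] : V G → V G → Set
  x ∈N[ w ] = x ≡ w ⊎ Adj x w

  _∈N?[_] : ∀ x w → Dec (x ∈N[ w ])
  x ∈N?[ w ] = (x Fin.≟ w) ⊎-dec adj? x w

  Independent-filter : ∀ {P : V G → Set} (P? : Decidable P) {xs} → Independent G xs → Independent G (filter P? xs)
  Independent-filter P? {xs} (unique , indep) =
    Unique.filter⁺ P? unique ,
    λ x∈ y∈ → indep (proj₁ (∈-filter⁻ P? {xs = xs} x∈)) (proj₁ (∈-filter⁻ P? {xs = xs} y∈))

  module _ {d : ℕ} (2≤d : 2 ≤ d) (K1-free : K1-Free G d) where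

    independent-neighbours⇒length< : ∀ {w xs} → Independent G xs → All (λ x → Adj x w) xs → length xs < d
    independent-neighbours⇒length< {w} {xs} (unique , indep) adjacent with d ≤? length xs
    ... | no d≰ = ≰⇒> d≰
    ... | yes d≤ = ⊥-elim (K1-free (w , leaf , leaf-injective ,
                                    (λ i → Adj-sym (All.lookup adjacent (∈-lookup _))) ,
                                    λ i j → indep (∈-lookup _) (∈-lookup _)))
      where
        leaf : Fin d → V G
        leaf i = lookup xs (inject≤ i d≤)
        leaf-injective : ∀ {i j} → leaf i ≡ leaf j → i ≡ j
        leaf-injective e = inject≤-injective _ _ _ _ (Unique⇒lookup-injective unique _ _ e)

    independent⊆N[w]⇒length≤ : ∀ w {xs} → Independent G xs → All (_∈N[ w ]) xs → length xs ≤ d ∸ 1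
    independent⊆N[w]⇒length≤ w {xs} ind@(unique , indep) ⊆N with w ∈? xs
    ... | yes w∈xs = ≤-trans (Unique-constant⇒length≤1 unique (All.tabulate equal)) (∸-monoˡ-≤ 1 2≤d)
      where
        equal : ∀ {x} → x ∈ xs → x ≡ w
        equal x∈xs with All.lookup ⊆N x∈xs
        ... | inj₁ x≡w = x≡w
        ... | inj₂ x~w = ⊥-elim (indep x∈xs w∈xs x~w)
    ... | no w∉xs = m<n⇒m≤n∸1 (independent-neighbours⇒length< ind (All.tabulate adjacent))
      where
        adjacent : ∀ {x} → x ∈ xs → Adj x w
        adjacent x∈xs with All.lookup ⊆N x∈xs
        ... | inj₁ refl = ⊥-elim (w∉xs x∈xs)
        ... | inj₂ x~w = x~w

    independent⊆⋃N⇒length≤ : ∀ k (w : Fin k → V G) {xs} → Independent G xs →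
      All (λ x → ∃ λ r → x ∈N[ w r ]) xs → length xs ≤ (d ∸ 1) * k
    independent⊆⋃N⇒length≤ zero w {[]} _ _ = z≤n
    independent⊆⋃N⇒length≤ zero w {_ ∷ _} _ ((() , _) ∷ _)
    independent⊆⋃N⇒length≤ (suc k) w {xs} ind ⊆⋃N = begin
      length xs                                                 ≡⟨ sym (length-filter+filter-∁ near? xs) ⟩
      length (filter near? xs) + length (filter (∁? near?) xs)  ≤⟨ +-mono-≤ first rest ⟩
      (d ∸ 1) + (d ∸ 1) * k                                     ≡⟨ sym (*-suc (d ∸ 1) k) ⟩
      (d ∸ 1) * suc k                                           ∎
      where
        open ≤-Reasoning
        near? = _∈N?[ w Fin.zero ]
        first = independent⊆N[w]⇒length≤ (w Fin.zero) (Independent-filter near? ind) (all-filter near? xs)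
        other-centre : ∀ {x} → ¬ x ∈N[ w Fin.zero ] × (∃ λ r → x ∈N[ w r ]) →
                       ∃ λ r → x ∈N[ w (Fin.suc r) ]
        other-centre (far , Fin.zero , near) = ⊥-elim (far near)
        other-centre (_ , Fin.suc r , near) = r , near
        rest = independent⊆⋃N⇒length≤ k (w ∘ Fin.suc) (Independent-filter (∁? near?) ind)
                 (All.zipWith other-centre (all-filter (∁? near?) xs , filter⁺ (∁? near?) ⊆⋃N))

  record IsInducedPathℕ (k : ℕ) (g : ℕ → V G) : Set where
    field
      injective : ∀ {s t} → s < k → t < k → g s ≡ g t → s ≡ t
      adjacent⇒consecutive : ∀ {s t} → s < k → t < k → Adj (g s) (g t) → Consecutive s t
      consecutive⇒adjacent : ∀ {s t} → s < k → t < k → Consecutive s t → Adj (g s) (g t)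

  shift : ∀ {L g} → IsInducedPathℕ L g → ∀ a {K} → a + K ≤ L → IsInducedPathℕ K (λ r → g (a + r))
  shift path a {K} a+K≤L = record
    { injective = λ s<K t<K e → +-cancelˡ-≡ a _ _ (injective (inside s<K) (inside t<K) e)
    ; adjacent⇒consecutive = λ s<K t<K → Consecutive-cancel a ∘ adjacent⇒consecutive (inside s<K) (inside t<K)
    ; consecutive⇒adjacent = λ s<K t<K → consecutive⇒adjacent (inside s<K) (inside t<K) ∘ Consecutive-+ a
    }
    where
      open IsInducedPathℕ path
      inside : ∀ {s} → s < K → a + s < _
      inside s<K = <-≤-trans (+-monoʳ-< a s<K) a+K≤L

  prepend : V G → (ℕ → V G) → ℕ → V G
  prepend x g zero = x
  prepend x g (suc s) = g s

  prepend-injective : ∀ {k g x} → IsInducedPathℕ k g → (∀ s → s < k → x ≢ g s) →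
    ∀ {s t} → s < suc k → t < suc k → prepend x g s ≡ prepend x g t → s ≡ t
  prepend-injective path x∉ {zero} {zero} _ _ _ = refl
  prepend-injective path x∉ {zero} {suc t} _ t<1+k e = ⊥-elim (x∉ t (≤-pred t<1+k) e)
  prepend-injective path x∉ {suc s} {zero} s<1+k _ e = ⊥-elim (x∉ s (≤-pred s<1+k) (sym e))
  prepend-injective path x∉ {suc s} {suc t} s<1+k t<1+k e =
    cong suc (IsInducedPathℕ.injective path (≤-pred s<1+k) (≤-pred t<1+k) e)

  prepend-induced : ∀ {k g x} → IsInducedPathℕ k g → (∀ s → s < k → x ≢ g s) → Adj x (g 0) →
    (∀ s → 1 ≤ s → s < k → ¬ Adj x (g s)) → IsInducedPathℕ (suc k) (prepend x g)
  prepend-induced {k} {g} {x} path x∉ x~g₀ x≁ = record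
    { injective = prepend-injective path x∉
    ; adjacent⇒consecutive = adj⇒con
    ; consecutive⇒adjacent = con⇒adj
    }
    where
      open IsInducedPathℕ path
      x~⇒0 : ∀ {t} → t < k → Adj x (g t) → t ≡ 0
      x~⇒0 {zero} _ _ = refl
      x~⇒0 {suc t} t<k a = ⊥-elim (x≁ (suc t) (s≤s z≤n) t<k a)
      adj⇒con : ∀ {s t} → s < suc k → t < suc k → Adj (prepend x g s) (prepend x g t) → Consecutive s t
      adj⇒con {zero} {zero} _ _ a = ⊥-elim (irr a)
      adj⇒con {zero} {suc t} _ t<1+k a = inj₁ (cong suc (sym (x~⇒0 (≤-pred t<1+k) a)))
      adj⇒con {suc s} {zero} s<1+k _ a = inj₂ (cong suc (sym (x~⇒0 (≤-pred s<1+k) (Adj-sym a))))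
      adj⇒con {suc s} {suc t} s<1+k t<1+k a = Consecutive-+ 1 (adjacent⇒consecutive (≤-pred s<1+k) (≤-pred t<1+k) a)
      con⇒adj : ∀ {s t} → s < suc k → t < suc k → Consecutive s t → Adj (prepend x g s) (prepend x g t)
      con⇒adj {zero} {zero} _ _ (inj₁ ())
      con⇒adj {zero} {zero} _ _ (inj₂ ())
      con⇒adj {zero} {suc t} _ _ (inj₁ refl) = x~g₀
      con⇒adj {suc s} {zero} _ _ (inj₂ refl) = Adj-sym x~g₀
      con⇒adj {suc s} {suc t} s<1+k t<1+k c =
        consecutive⇒adjacent (≤-pred s<1+k) (≤-pred t<1+k) (Consecutive-cancel 1 c)

  endpoints-neighbour⇒InducedCycle : ∀ {k g x} → 1 ≤ k → IsInducedPathℕ (suc k) g →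
    (∀ s → s < suc k → x ≢ g s) → Adj x (g 0) → Adj x (g k) → (∀ s → 1 ≤ s → s < k → ¬ Adj x (g s)) → InducedCycle G (2 + k)
  endpoints-neighbour⇒InducedCycle {k} {g} {x} 1≤k path x∉ x~g₀ x~gₖ x≁ =
    s≤s (s≤s 1≤k) , prepend x g ∘ toℕ ,
    (λ e → toℕ-injective (prepend-injective path x∉ (toℕ<n _) (toℕ<n _) e)) ,
    λ i j → adj⇒cyc (toℕ<n i) (toℕ<n j) , cyc⇒adj (toℕ<n i) (toℕ<n j)
    where
      open IsInducedPathℕ path
      K = 2 + k
      x~⇒cyc : ∀ {t} → t ≤ k → Adj x (g t) → CyclicallyConsecutive K 0 (suc t)
      x~⇒cyc {zero} _ _ = inj₁ refl
      x~⇒cyc {suc t} 1+t≤k a with m≤n⇒m<n∨m≡n 1+t≤k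
      ... | inj₁ 1+t<k = ⊥-elim (x≁ (suc t) (s≤s z≤n) 1+t<k a)
      ... | inj₂ refl = inj₂ (inj₂ (inj₂ (refl , refl)))
      cyc⇒x~ : ∀ {t} → CyclicallyConsecutive K 0 (suc t) → Adj x (g t)
      cyc⇒x~ (inj₁ refl) = x~g₀
      cyc⇒x~ (inj₂ (inj₁ ()))
      cyc⇒x~ (inj₂ (inj₂ (inj₁ (_ , ()))))
      cyc⇒x~ (inj₂ (inj₂ (inj₂ (refl , _)))) = x~gₖ
      adj⇒cyc : ∀ {s t} → s < K → t < K → Adj (prepend x g s) (prepend x g t) → CyclicallyConsecutive K s t
      adj⇒cyc {zero} {zero} _ _ a = ⊥-elim (irr a)
      adj⇒cyc {zero} {suc t} _ t<K a = x~⇒cyc (≤-pred (≤-pred t<K)) a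
      adj⇒cyc {suc s} {zero} s<K _ a = CyclicallyConsecutive-sym (x~⇒cyc (≤-pred (≤-pred s<K)) (Adj-sym a))
      adj⇒cyc {suc s} {suc t} s<K t<K a =
        Consecutive⇒CyclicallyConsecutive (Consecutive-+ 1 (adjacent⇒consecutive (≤-pred s<K) (≤-pred t<K) a))
      cyc⇒adj : ∀ {s t} → s < K → t < K → CyclicallyConsecutive K s t → Adj (prepend x g s) (prepend x g t)
      cyc⇒adj {zero} {zero} _ _ (inj₁ ())
      cyc⇒adj {zero} {zero} _ _ (inj₂ (inj₁ ()))
      cyc⇒adj {zero} {zero} _ _ (inj₂ (inj₂ (inj₁ (() , _))))
      cyc⇒adj {zero} {zero} _ _ (inj₂ (inj₂ (inj₂ (() , _))))
      cyc⇒adj {zero} {suc t} _ _ c = cyc⇒x~ c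
      cyc⇒adj {suc s} {zero} _ _ c = Adj-sym (cyc⇒x~ (CyclicallyConsecutive-sym c))
      cyc⇒adj {suc s} {suc t} s<K t<K (inj₁ e) =
        consecutive⇒adjacent (≤-pred s<K) (≤-pred t<K) (inj₁ (suc-injective e))
      cyc⇒adj {suc s} {suc t} s<K t<K (inj₂ (inj₁ e)) =
        consecutive⇒adjacent (≤-pred s<K) (≤-pred t<K) (inj₂ (suc-injective e))
      cyc⇒adj {suc s} {suc t} _ _ (inj₂ (inj₂ (inj₁ (_ , ()))))
      cyc⇒adj {suc s} {suc t} _ _ (inj₂ (inj₂ (inj₂ (_ , ()))))

  module Backbone (l : ℕ) (g : ℕ → V G) (h : ℕ) where

    Attached : V G → ℕ → Set
    Attached x t = t < l × x ∈N[ g t ]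

    Attached? : ∀ x → Decidable (Attached x)
    Attached? x t = (t <? l) ×-dec (x ∈N?[ g t ])

    OffPath : V G → Set
    OffPath x = ∀ t → t < l → x ≢ g t

    InWindow : ℕ → V G → Set
    InWindow i x = ∃ λ t → t < l × i ≤ t × t < i + h × x ∈N[ g t ]

    InWindow? : ∀ i x → Dec (InWindow i x)
    InWindow? i x = anyUpTo? (λ t → (i ≤? t) ×-dec (t <? i + h) ×-dec (x ∈N?[ g t ])) l

    Near : V G → V G → Set
    Near u v = ∃ λ s → s < l × ∃ λ t → t < l × u ∈N[ g s ] × v ∈N[ g t ] × s < t + h × t < s + h

    Near? : ∀ u v → Dec (Near u v)
    Near? u v = anyUpTo? (λ s → anyUpTo? (λ t →
      (u ∈N?[ g s ]) ×-dec (v ∈N?[ g t ]) ×-dec (s <? t + h) ×-dec (t <? s + h)) l) l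

    Near-sym : ∀ {u v} → Near u v → Near v u
    Near-sym (s , s<l , t , t<l , u∈ , v∈ , s<t+h , t<s+h) = t , t<l , s , s<l , v∈ , u∈ , t<s+h , s<t+h

    InWindow⇒⋃N : ∀ {i x} → InWindow i x → ∃ λ (r : Fin h) → x ∈N[ g (i + toℕ r) ]
    InWindow⇒⋃N {i} {x} (t , _ , i≤t , t<i+h , x∈N) with m≤n⇒∃[o]m+o≡n i≤t
    ... | r , refl = fromℕ< (+-cancelˡ-< i r h t<i+h) ,
                     subst (λ s → x ∈N[ g (i + s) ]) (sym (toℕ-fromℕ< _)) x∈N

    common-window : h ≤ l → ∀ {x y s t} → s ≤ t → t < s + h → Attached x s → Attached y t →
      ∃ λ i → i ≤ l ∸ h × InWindow i x × InWindow i y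
    common-window h≤l {s = s} {t} s≤t t<s+h (s<l , x∈N) (t<l , y∈N) with s ≤? l ∸ h
    ... | yes s≤l∸h = s , s≤l∸h , (s , s<l , ≤-refl , ≤-<-trans s≤t t<s+h , x∈N) ,
                      (t , t<l , s≤t , t<s+h , y∈N)
    ... | no s≰l∸h = l ∸ h , ≤-refl , (s , s<l , l∸h≤s , ≤-<-trans s≤t t<l∸h+h , x∈N) ,
                     (t , t<l , ≤-trans l∸h≤s s≤t , t<l∸h+h , y∈N)
      where
        l∸h≤s = <⇒≤ (≰⇒> s≰l∸h)
        t<l∸h+h = subst (t <_) (sym (m∸n+n≡m h≤l)) t<l

    module Decomposition (path : IsInducedPathℕ l g) (2≤h : 2 ≤ h) (h≤l : h ≤ l)
                         {q : ℕ} (q≤1+h : q ≤ suc h) (no-holes : NoLongHoles G q) where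
      open IsInducedPathℕ path

      0<h : 0 < h
      0<h = ≤-trans (s≤s z≤n) 2≤h

      attached⇒adjacent : ∀ {x t} → OffPath x → Attached x t → Adj x (g t)
      attached⇒adjacent off (t<l , inj₁ x≡gt) = ⊥-elim (off _ t<l x≡gt)
      attached⇒adjacent off (_ , inj₂ x~gt) = x~gt

      ¬attached⇒¬adjacent : ∀ {x t} → t < l → ¬ Attached x t → ¬ Adj x (g t)
      ¬attached⇒¬adjacent t<l ¬x∼t x~gt = ¬x∼t (t<l , inj₂ x~gt)

      path-vertex-attachments : ∀ {s t} → t < l → Attached (g t) s → s ≤ suc t × t ≤ suc s
      path-vertex-attachments {s} {t} t<l (s<l , inj₁ gt≡gs) with injective t<l s<l gt≡gs
      ... | refl = n≤1+n t , n≤1+n t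
      path-vertex-attachments {s} {t} t<l (s<l , inj₂ gt~gs) with adjacent⇒consecutive t<l s<l gt~gs
      ... | inj₁ refl = ≤-refl , m≤n+m t 2
      ... | inj₂ refl = m≤n+m s 2 , ≤-refl

      segment : ∀ A e → A + e < l → IsInducedPathℕ (suc e) (λ r → g (A + r))
      segment A e A+e<l = shift path A (subst (_≤ l) (sym (+-suc A e)) A+e<l)

      vertex-gap⇒InducedCycle : ∀ {x} A e → A + e < l → 1 ≤ e → OffPath x → Attached x A → Attached x (A + e) →
        (∀ t → A < t → t < A + e → ¬ Attached x t) → InducedCycle G (2 + e)
      vertex-gap⇒InducedCycle {x} A e A+e<l 1≤e off x∼A x∼B between =
        endpoints-neighbour⇒InducedCycle 1≤e (segment A e A+e<l)
          (λ r r≤e → off (A + r) (inside (≤-pred r≤e)))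
          (subst (Adj x ∘ g) (sym (+-identityʳ A)) (attached⇒adjacent off x∼A))
          (attached⇒adjacent off x∼B)
          (λ r 1≤r r<e → ¬attached⇒¬adjacent (inside (<⇒≤ r<e)) (between (A + r) (m<m+n A 1≤r) (+-monoʳ-< A r<e)))
        where
          inside : ∀ {r} → r ≤ e → A + r < l
          inside r≤e = ≤-<-trans (+-monoʳ-≤ A r≤e) A+e<l

      edge-gap⇒InducedCycle : ∀ {u v} A e → A + e < l → Adj u v → OffPath u → OffPath v →
        Attached u A → Attached v (A + e) →
        (∀ t → A < t → t ≤ A + e → ¬ Attached u t) → (∀ t → A ≤ t → t < A + e → ¬ Attached v t) →
        InducedCycle G (3 + e)
      edge-gap⇒InducedCycle {u} {v} A e A+e<l u~v u-off v-off u∼A v∼B u-after v-before =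
        endpoints-neighbour⇒InducedCycle (s≤s z≤n) u-segment v∉ (Adj-sym u~v) (attached⇒adjacent v-off v∼B)
          (λ { (suc r) _ 1+r<1+e → let r<e = ≤-pred 1+r<1+e in
               ¬attached⇒¬adjacent (inside (<⇒≤ r<e)) (v-before (A + r) (m≤m+n A r) (+-monoʳ-< A r<e)) })
        where
          inside : ∀ {r} → r ≤ e → A + r < l
          inside r≤e = ≤-<-trans (+-monoʳ-≤ A r≤e) A+e<l
          u-segment : IsInducedPathℕ (2 + e) (prepend u (λ r → g (A + r)))
          u-segment = prepend-induced (segment A e A+e<l)
            (λ r r≤e → u-off (A + r) (inside (≤-pred r≤e)))
            (subst (Adj u ∘ g) (sym (+-identityʳ A)) (attached⇒adjacent u-off u∼A))
            (λ r 1≤r r<1+e → let r≤e = ≤-pred r<1+e in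
               ¬attached⇒¬adjacent (inside r≤e) (u-after (A + r) (m<m+n A 1≤r) (+-monoʳ-≤ A r≤e)))
          v∉ : ∀ s → s < 2 + e → v ≢ prepend u (λ r → g (A + r)) s
          v∉ zero _ refl = irr u~v
          v∉ (suc r) r<1+e = v-off (A + r) (inside (≤-pred (≤-pred r<1+e)))

      far-edge⇒⊥ : ∀ {u v tu tv} → Adj u v → ¬ Near u v → Attached u tu → Attached v tv → tu ≤ tv → ⊥
      far-edge⇒⊥ {u} {v} {tu} {tv} u~v ¬near u∼tu v∼tv tu≤tv
        with last-below (Attached? u) (suc tv) (tu , s≤s tu≤tv , u∼tu)
      ... | A , A<1+tv , u∼A , u-after
        with first-from (Attached? v) (suc tv) (tv , ≤-refl , ≤-pred A<1+tv , v∼tv)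
      ... | B , B<1+tv , A≤B , v∼B , v-before with m≤n⇒∃[o]m+o≡n A≤B
      ... | e , refl = no-holes (3 + e) q≤3+e
            (edge-gap⇒InducedCycle A e (proj₁ v∼B) u~v u-off v-off u∼A v∼B
              (λ t A<t t≤A+e → u-after t A<t (≤-<-trans t≤A+e B<1+tv)) v-before)
        where
          u-off : OffPath u
          u-off t t<l refl = ¬near (t , t<l , t , t<l , inj₁ refl , inj₂ (Adj-sym u~v) , m<m+n t 0<h , m<m+n t 0<h)
          v-off : OffPath v
          v-off t t<l refl = ¬near (t , t<l , t , t<l , inj₂ u~v , inj₁ refl , m<m+n t 0<h , m<m+n t 0<h)
          h≤e : h ≤ e
          h≤e = ≮⇒≥ λ e<h → ¬near (A , proj₁ u∼A , A + e , proj₁ v∼B , proj₂ u∼A , proj₂ v∼B ,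
                                   ≤-<-trans (m≤m+n A e) (m<m+n (A + e) 0<h) , +-monoʳ-< A e<h)
          q≤3+e : q ≤ 3 + e
          q≤3+e = ≤-trans q≤1+h (≤-trans (s≤s h≤e) (m≤n+m (suc e) 2))

      attachment-gap⇒⊥ : ∀ {x m₁ m₂ j} → Attached x m₁ → Attached x m₂ → m₁ < j → j + h ≤ m₂ →
        (∀ t → j ≤ t → t < j + h → ¬ Attached x t) → ⊥
      attachment-gap⇒⊥ {x} {m₁} {m₂} {j} x∼m₁ x∼m₂ m₁<j j+h≤m₂ gap
        with last-below (Attached? x) j (m₁ , m₁<j , x∼m₁)
           | first-from (Attached? x) (suc m₂) (m₂ , ≤-refl , ≤-trans (m≤m+n j h) j+h≤m₂ , x∼m₂)
      ... | A , A<j , x∼A , after | B , _ , j≤B , x∼B , before with m≤n⇒∃[o]m+o≡n (≤-trans (<⇒≤ A<j) j≤B)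
      ... | e , refl = no-holes (2 + e) q≤2+e
            (vertex-gap⇒InducedCycle A e (proj₁ x∼B) (≤-trans (s≤s z≤n) 1+h≤e) off x∼A x∼B between)
        where
          1+h≤e : suc h ≤ e
          1+h≤e = +-cancelˡ-≤ A (suc h) e (begin
            A + suc h  ≡⟨ +-suc A h ⟩
            suc A + h  ≤⟨ +-monoˡ-≤ h A<j ⟩
            j + h      ≤⟨ ≮⇒≥ (λ A+e<j+h → gap (A + e) j≤B A+e<j+h x∼B) ⟩
            A + e      ∎)
            where open ≤-Reasoning
          between : ∀ t → A < t → t < A + e → ¬ Attached x t
          between t A<t t<A+e with t <? j
          ... | yes t<j = after t A<t t<j
          ... | no t≮j = before t (≮⇒≥ t≮j) t<A+e
          -- A path vertex is attached only within distance 1 of its own position, but A and A + e are h + 1 ≥ 3 apart.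
          off : OffPath x
          off t t<l refl with path-vertex-attachments t<l x∼A | path-vertex-attachments t<l x∼B
          ... | _ , t≤1+A | A+e≤1+t , _ = <⇒≱ (+-monoʳ-< A (≤-trans (s≤s 2≤h) 1+h≤e))
                                             (subst (A + e ≤_) (+-comm 2 A) (≤-trans A+e≤1+t (s≤s t≤1+A)))
          q≤2+e : q ≤ 2 + e
          q≤2+e = ≤-trans q≤1+h (≤-trans 1+h≤e (m≤n+m e 2))

      attached⇒InWindow : ∀ {x t} → Attached x t → ∃ λ i → i ≤ l ∸ h × InWindow i x
      attached⇒InWindow x∼t with common-window h≤l ≤-refl (m<m+n _ 0<h) x∼t x∼t
      ... | i , i≤l∸h , in-i , _ = i , i≤l∸h , in-i

      adjacent⇒common-window : ∀ {u v tu tv} → Adj u v → Attached u tu → Attached v tv →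
        ∃ λ i → i ≤ l ∸ h × InWindow i u × InWindow i v
      adjacent⇒common-window {u} {v} {tu} {tv} u~v u∼tu v∼tv with Near? u v
      ... | no ¬near with ≤-total tu tv
      ...   | inj₁ tu≤tv = ⊥-elim (far-edge⇒⊥ u~v ¬near u∼tu v∼tv tu≤tv)
      ...   | inj₂ tv≤tu = ⊥-elim (far-edge⇒⊥ (Adj-sym u~v) (¬near ∘ Near-sym) v∼tv u∼tu tv≤tu)
      adjacent⇒common-window _ _ _ | yes (s , s<l , t , t<l , u∈ , v∈ , s<t+h , t<s+h) with ≤-total s t
      ... | inj₁ s≤t = common-window h≤l s≤t t<s+h (s<l , u∈) (t<l , v∈)
      ... | inj₂ t≤s with common-window h≤l t≤s s<t+h (t<l , v∈) (s<l , u∈)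
      ...   | i , i≤l∸h , in-v , in-u = i , i≤l∸h , in-u , in-v

      InWindow-convex : ∀ {x i j k} → i ≤ j → j ≤ k → InWindow i x → InWindow k x → InWindow j x
      InWindow-convex {x} {i} {j} i≤j j≤k (m₁ , m₁<l , _ , m₁<i+h , x∈N₁) (m₂ , m₂<l , k≤m₂ , _ , x∈N₂)
        with InWindow? j x
      ... | yes in-j = in-j
      ... | no ¬in-j = ⊥-elim (attachment-gap⇒⊥ (m₁<l , x∈N₁) (m₂<l , x∈N₂) m₁<j j+h≤m₂ gap)
        where
          gap : ∀ t → j ≤ t → t < j + h → ¬ Attached x t
          gap t j≤t t<j+h (t<l , x∈N) = ¬in-j (t , t<l , j≤t , t<j+h , x∈N)
          m₁<j : m₁ < j
          m₁<j = ≰⇒> λ j≤m₁ →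
            ¬in-j (m₁ , m₁<l , j≤m₁ , <-≤-trans m₁<i+h (+-monoˡ-≤ h i≤j) , x∈N₁)
          j+h≤m₂ : j + h ≤ m₂
          j+h≤m₂ = ≮⇒≥ λ m₂<j+h → ¬in-j (m₂ , m₂<l , ≤-trans j≤k k≤m₂ , m₂<j+h , x∈N₂)

  -- Positions t ≥ l are sent to an arbitrary vertex v₀; every use of the extension is guarded by t < l.
  module _ {l : ℕ} (P : Fin l → V G) (v₀ : V G) where

    extend : ℕ → V G
    extend t with t <? l
    ... | yes t<l = P (fromℕ< t<l)
    ... | no _ = v₀

    extend-fromℕ< : ∀ {t} (t<l : t < l) → extend t ≡ P (fromℕ< t<l)
    extend-fromℕ< {t} t<l with t <? l
    ... | yes _ = refl
    ... | no t≮l = ⊥-elim (t≮l t<l)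

    extend-toℕ : ∀ m → extend (toℕ m) ≡ P m
    extend-toℕ m = trans (extend-fromℕ< (toℕ<n m)) (cong P (fromℕ<-toℕ m _))

    extend-induced : IsInducedPath G l P → IsInducedPathℕ l extend
    extend-induced (P-injective , P-adjacency) = record
      { injective = λ s<l t<l e → begin
          _                 ≡⟨ toℕ-fromℕ< s<l ⟨
          toℕ (fromℕ< s<l)  ≡⟨ cong toℕ (P-injective (trans (sym (extend-fromℕ< s<l)) (trans e (extend-fromℕ< t<l)))) ⟩
          toℕ (fromℕ< t<l)  ≡⟨ toℕ-fromℕ< t<l ⟩
          _                 ∎
      ; adjacent⇒consecutive = λ s<l t<l a → subst₂ Consecutive (toℕ-fromℕ< s<l) (toℕ-fromℕ< t<l)
          (proj₁ (P-adjacency _ _) (subst₂ Adj (extend-fromℕ< s<l) (extend-fromℕ< t<l) a))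
      ; consecutive⇒adjacent = λ s<l t<l c → subst₂ Adj (sym (extend-fromℕ< s<l)) (sym (extend-fromℕ< t<l))
          (proj₂ (P-adjacency _ _) (subst₂ Consecutive (sym (toℕ-fromℕ< s<l)) (sym (toℕ-fromℕ< t<l)) c))
      }
      where open ≡-Reasoning

    module _ (h : ℕ) where
      open Backbone l extend h

      backbone⇒InWindow : ∀ {b x} → backbone G P h b x → InWindow (toℕ b) x
      backbone⇒InWindow {x = x} (_ , (m , b≤m , m<b+h , refl) , x∈N) =
        toℕ m , toℕ<n m , b≤m , m<b+h , subst (x ∈N[_]) (sym (extend-toℕ m)) x∈N

      InWindow⇒backbone : ∀ {b x} → InWindow (toℕ b) x → backbone G P h b x
      InWindow⇒backbone {b} (t , t<l , b≤t , t<b+h , x∈N) =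
        extend t , (fromℕ< t<l , subst (toℕ b ≤_) (sym (toℕ-fromℕ< t<l)) b≤t ,
                    subst (_< toℕ b + h) (sym (toℕ-fromℕ< t<l)) t<b+h , extend-fromℕ< t<l) , x∈N

      N[Img]⇒attached : ∀ {x} → N[_] G (Img G P) x → ∃ (Attached x)
      N[Img]⇒attached {x} (_ , (m , refl) , x∈N) = toℕ m , toℕ<n m , subst (x ∈N[_]) (sym (extend-toℕ m)) x∈N

      bag : ∀ {i} → i ≤ l ∸ h → Fin (l ∸ h + 1)
      bag {i} i≤l∸h = fromℕ< (subst (i <_) (+-comm 1 (l ∸ h)) (s≤s i≤l∸h))

      InWindow⇒bag : ∀ {i x} (i≤l∸h : i ≤ l ∸ h) → InWindow i x → backbone G P h (bag i≤l∸h) x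
      InWindow⇒bag {x = x} i≤l∸h = InWindow⇒backbone ∘ subst (λ j → InWindow j x) (sym (toℕ-fromℕ< _))

      backbone-independence : ∀ {d} → 2 ≤ d → K1-Free G d →
        PathDecompIndepAtMost G (l ∸ h + 1) (backbone G P h) ((d ∸ 1) * h)
      backbone-independence 2≤d K1-free b xs ind ⊆bag =
        independent⊆⋃N⇒length≤ 2≤d K1-free h (λ r → extend (toℕ b + toℕ r)) ind
          (All.map (InWindow⇒⋃N ∘ backbone⇒InWindow) ⊆bag)

      backbone-isPathDecomposition : IsInducedPath G l P → 2 ≤ h → h ≤ l →
        ∀ {q} → q ≤ suc h → NoLongHoles G q →
        IsPathDecomposition G (N[_] G (Img G P)) (l ∸ h + 1) (backbone G P h)
      backbone-isPathDecomposition path 2≤h h≤l q≤1+h no-holes =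
        (λ { _ _ (u , (m , _ , _ , u≡Pm) , x∈N) → u , (m , u≡Pm) , x∈N }) ,
        (λ x x∈X → let _ , x∼t = N[Img]⇒attached x∈X
                       i , i≤l∸h , in-i = attached⇒InWindow x∼t
                   in bag i≤l∸h , InWindow⇒bag i≤l∸h in-i) ,
        (λ u v u∈X v∈X u~v → let _ , u∼tu = N[Img]⇒attached u∈X
                                 _ , v∼tv = N[Img]⇒attached v∈X
                                 i , i≤l∸h , u-in-i , v-in-i = adjacent⇒common-window u~v u∼tu v∼tv
                             in bag i≤l∸h , InWindow⇒bag i≤l∸h u-in-i , InWindow⇒bag i≤l∸h v-in-i) ,
        (λ x i j k i≤j j≤k x∈i x∈k →
           InWindow⇒backbone (InWindow-convex i≤j j≤k (backbone⇒InWindow x∈i) (backbone⇒InWindow x∈k)))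
        where open Decomposition (extend-induced path) 2≤h h≤l q≤1+h no-holes

lemma4p7 : (d q : ℕ) → 2 ≤ d → 3 ≤ q → (G : Graph) → Connected G → K1-Free G d → NoLongHoles G q →
    (h : ℕ) → q ∸ 1 ≤ h → (l : ℕ) → (P : Fin l → V G) → IsInducedPath G l P → h ≤ l →
    IsPathDecomposition G (N[_] G (Img G P)) (l ∸ h + 1) (backbone G P h)
    × PathDecompIndepAtMost G (l ∸ h + 1) (backbone G P h) ((d ∸ 1) * h)
lemma4p7 d q 2≤d 3≤q G _ K1-free no-holes h q∸1≤h l P path h≤l =
  backbone-isPathDecomposition G P v₀ h path 2≤h h≤l q≤1+h no-holes ,
  backbone-independence G P v₀ h 2≤d K1-free
  where
    2≤h : 2 ≤ h
    2≤h = ≤-trans (∸-monoˡ-≤ 1 3≤q) q∸1≤h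
    q≤1+h : q ≤ suc h
    q≤1+h = ≤-trans (m≤n+m∸n q 1) (s≤s q∸1≤h)
    v₀ : V G
    v₀ = P (fromℕ< (≤-trans (s≤s z≤n) (≤-trans 2≤h h≤l)))
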